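{- Let $n,k,w$ be integers with $k < w < kn$. Let $\alpha_1=\mathtt{a}_1\mathtt{a}_2\cdots\mathtt{a}_n$ be the lexicographically smallest necklace in $\mathbf{N}_k(n,w^\uparrow)$. Let $\mathbf{s}\in\mathbf{S}_k(n,w^\uparrow)$ be a string that is not of the form $\mathtt{k}^{n-j}\mathtt{a}_1\cdots\mathtt{a}_j$ for any $0\le j<n$. Write $\mathbf{s}=\mathbf{p}\mathbf{q}$ where $\mathbf{q}$ is the longest suffix of $\mathbf{s}$ such that $\mathbf{q}\mathbf{p}$ is a necklace. Let $\beta_1,\beta_2$ be the unique consecutive necklaces in the lexicographically ordered list $\mathbf{N}_k(n)$ (considered cyclically) such that $\mathbf{p}$ is a suffix of $\beta_1$ and $\mathbf{q}$ is a prefix of $\beta_2$. Let $\delta_2$ be the smallest necklace in $\mathbf{N}_k(n,w^\uparrow)$ that is lexicographically larger than or equal to $\beta_2$, and let $\delta_3$ be the necklace immediately following $\delta_2$ in $\mathbf{N}_k(n,w^\uparrow)$. Then $\mathrm{ap}(\delta_2)\mathrm{ap}(\delta_3)$ has prefix $\mathbf{q}$.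
   Context: $\mathbf{S}_k(n)$ is the set of length-$n$ strings over the alphabet $\{\mathtt{1},\mathtt{2},\ldots,\mathtt{k}\}$ (symbols ordered as integers); the weight of a string is the sum of its symbols; $\mathbf{S}_k(n,w^\uparrow)$ is the set of strings in $\mathbf{S}_k(n)$ of weight at least $w$. A necklace is a string that is lexicographically smallest among all its rotations. $\mathbf{N}_k(n)$ is the list of all necklaces in $\mathbf{S}_k(n)$ in lexicographic order, and $\mathbf{N}_k(n,w^\uparrow)$ is the list of necklaces in $\mathbf{S}_k(n,w^\uparrow)$ in lexicographic order. For a string $\mathbf{s}$, $\mathrm{ap}(\mathbf{s})$ (the aperiodic prefix) is the shortest string $\mathbf{t}$ with $\mathbf{s}=\mathbf{t}^j$ for some $j\ge1$. $\mathtt{k}^{m}$ denotes the symbol $\mathtt{k}$ repeated $m$ times. It is a known fact that $\beta_1,\beta_2$ as in the claim exist and are unique. -}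

module Defs where

open import Data.Nat using (ℕ; _<_; _≤_)
open import Data.List using (List; []; _∷_; _++_; drop; take; length; concat; replicate)
open import Data.Nat.ListAction using (sum)
open import Data.List.Relation.Unary.All using (All)
open import Data.Product using (_×_; ∃; Σ)
open import Data.Sum using (_⊎_)
open import Relation.Binary.PropositionalEquality using (_≡_)

-- Strings are lists of natural numbers; symbol i is the number i.

data _<ₗ_ : List ℕ → List ℕ → Set where
  []<∷  : ∀ {y ys} → [] <ₗ (y ∷ ys)
  here  : ∀ {x y xs ys} → x < y → (x ∷ xs) <ₗ (y ∷ ys)
  there : ∀ {x xs ys} → xs <ₗ ys → (x ∷ xs) <ₗ (x ∷ ys)

_≤ₗ_ : List ℕ → List ℕ → Set
a ≤ₗ b = a <ₗ b ⊎ a ≡ b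

rotate : ℕ → List ℕ → List ℕ
rotate i s = drop i s ++ take i s

IsNecklace : List ℕ → Set
IsNecklace s = ∀ i → i < length s → s ≤ₗ rotate i s

weight : List ℕ → ℕ
weight = sum

InS : ℕ → ℕ → List ℕ → Set
InS k n s = length s ≡ n × All (λ a → 1 ≤ a × a ≤ k) s

InSw : ℕ → ℕ → ℕ → List ℕ → Set
InSw k n w s = InS k n s × w ≤ weight s

InN : ℕ → ℕ → List ℕ → Set
InN k n s = InS k n s × IsNecklace s

InNw : ℕ → ℕ → ℕ → List ℕ → Set
InNw k n w s = InSw k n w s × IsNecklace s

CyclicNext : (List ℕ → Set) → List ℕ → List ℕ → Set
CyclicNext P a b = P a × P b ×
  ((a <ₗ b × (∀ c → P c → a <ₗ c → b ≤ₗ c))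
   ⊎ ((∀ c → P c → c ≤ₗ a) × (∀ c → P c → b ≤ₗ c)))

Prefix : List ℕ → List ℕ → Set
Prefix q l = ∃ λ r → q ++ r ≡ l

Suffix : List ℕ → List ℕ → Set
Suffix p l = ∃ λ r → r ++ p ≡ l

IsAp : List ℕ → List ℕ → Set
IsAp t s = (∃ λ j → 1 ≤ j × s ≡ concat (replicate j t))
         × (∀ u j → 1 ≤ j → s ≡ concat (replicate j u) → length t ≤ length u)

-- Replacing a suffix of a necklace by k's yields a necklace of no smaller weight. For
-- β₂ = q r this puts q k^|r| into N_k(n, w↑) (its weight is at least that of s = p q), so
-- β₂ ≤ δ₂ ≤ q k^|r| and q is a prefix of δ₂. If q is longer than t₂ = ap(δ₂), write
-- q = t₂ q″; by periodicity δ₂ = q″ y where y ends with t₂, whose first symbol is the first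
-- symbol of the necklace q p and hence below k (as s ≠ k^n). So q″ k^|y| ∈ N_k(n, w↑) lies
-- above δ₂, whence δ₂ < δ₃ ≤ q″ k^|y| and q″ is a common prefix of δ₂ and δ₃. Finally, a
-- common prefix of a necklace δ₂ and a larger δ₃ of the same length is a prefix of ap(δ₃):
-- if they first differed beyond |ap(δ₃)|, rotating δ₂ by |ap(δ₃)| would make it smaller.
-- Of the hypotheses on s only s ≠ k^n (the case j = 0) is needed.
module Submission where

open import Defs
open import Data.Nat using (ℕ; zero; suc; _<_; _≤_; _*_; _∸_; _+_; z≤n; s≤s; >-nonZero; >-nonZero⁻¹)
open import Data.Nat.Properties
open import Data.Nat.ListAction.Properties using (sum-++; sum-↭)
open import Data.List using (List; []; _∷_; _++_; take; drop; replicate; length; concat)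
open import Data.List.Properties
  using ( ++-assoc; ++-identityʳ; ∷-injective; ∷-injectiveʳ; length-++; length-replicate; length-++-comm
        ; length-++-≤ˡ; length-++-≤ʳ; length-++-sucʳ; length-take; take++drop≡id )
open import Data.List.Relation.Binary.Permutation.Propositional.Properties using (++-comm)
open import Data.List.Relation.Unary.All as All using (All; []; _∷_)
open import Data.List.Relation.Unary.All.Properties using (++⁺; ++⁻ˡ; ++⁻ʳ; replicate⁺; All¬⇒¬Any)
open import Data.List.Relation.Unary.Any using (Any; here; there)
import Data.List.Relation.Unary.Any.Properties as Any
open import Data.List.Membership.Propositional.Properties using (∈-∃++)
open import Data.Product using (∃; ∃₂; _×_; _,_; proj₁; proj₂; map₁; map₂)
open import Data.Sum using (_⊎_; inj₁; inj₂; [_,_]′)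
open import Data.Empty using (⊥-elim)
open import Function using (_∘_; case_of_)
open import Relation.Nullary using (¬_; yes; no)
open import Relation.Binary.PropositionalEquality

private variable
  A : Set

++-split : ∀ (u : List A) {x v y} → u ++ x ≡ v ++ y → length v ≤ length u →
           ∃ λ m → u ≡ v ++ m × y ≡ m ++ x
++-split u {v = []} eq _ = u , refl , sym eq
++-split (c ∷ u) {v = d ∷ v} eq (s≤s |v|≤|u|) with refl , eq′ ← ∷-injective eq =
  map₂ (map₁ (cong (c ∷_))) (++-split u eq′ |v|≤|u|)

++-split-< : ∀ (u : List A) {x v b y} → u ++ x ≡ v ++ b ∷ y → length v < length u →
             ∃ λ m → u ≡ v ++ b ∷ m
++-split-< (c ∷ u) {v = []} refl _ = u , refl
++-split-< (c ∷ u) {v = d ∷ v} eq (s≤s |v|<|u|) with refl , eq′ ← ∷-injective eq =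
  map₂ (cong (c ∷_)) (++-split-< u eq′ |v|<|u|)

splitAt-length : ∀ i (xs : List A) → i ≤ length xs → ∃₂ λ u v → xs ≡ u ++ v × length u ≡ i
splitAt-length i xs i≤|xs| =
  take i xs , drop i xs , sym (take++drop≡id i xs) , trans (length-take i xs) (m≤n⇒m⊓n≡m i≤|xs|)

take-length-++ : ∀ (u : List A) {v} → take (length u) (u ++ v) ≡ u
take-length-++ []      = refl
take-length-++ (a ∷ u) = cong (a ∷_) (take-length-++ u)

drop-length-++ : ∀ (u : List A) {v} → drop (length u) (u ++ v) ≡ v
drop-length-++ []      = refl
drop-length-++ (a ∷ u) = drop-length-++ u

All-conjugate : ∀ {P : A → Set} u m {v} → u ++ m ≡ m ++ v → All P v → All P u
All-conjugate u [] eq pv = subst (All _) (trans (sym eq) (++-identityʳ u)) pv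
All-conjugate [] (b ∷ m) _ _ = []
All-conjugate (a ∷ u) (b ∷ m) eq pv with refl , eq′ ← ∷-injective eq =
  All.head (++⁻ʳ u pu) ∷ ++⁻ˡ u pu
  where
    pu : All _ (u ++ a ∷ [])
    pu = All-conjugate (u ++ a ∷ []) m (trans (++-assoc u (a ∷ []) m) eq′) pv

All-≡⇒replicate : ∀ {k : A} {xs} → All (_≡ k) xs → xs ≡ replicate (length xs) k
All-≡⇒replicate []           = refl
All-≡⇒replicate (refl ∷ all) = cong (_ ∷_) (All-≡⇒replicate all)

concat-replicate-comm : ∀ i (t : List A) → t ++ concat (replicate i t) ≡ concat (replicate i t) ++ t
concat-replicate-comm zero    t = ++-identityʳ t
concat-replicate-comm (suc i) t =
  trans (cong (t ++_) (concat-replicate-comm i t)) (sym (++-assoc t _ t))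

concat-replicate-[] : ∀ i → concat (replicate i ([] {A = A})) ≡ []
concat-replicate-[] zero    = refl
concat-replicate-[] (suc i) = concat-replicate-[] i

root-nonempty : ∀ {δ} {t : List A} i → 0 < length δ → δ ≡ concat (replicate i t) → t ≢ []
root-nonempty i 0<|δ| δ≡tⁱ refl = <⇒≢ 0<|δ| (sym (cong length (trans δ≡tⁱ (concat-replicate-[] i))))

-- Lexicographic order

<ₗ-irrefl : ∀ {x} → ¬ x <ₗ x
<ₗ-irrefl (here a<a)  = <-irrefl refl a<a
<ₗ-irrefl (there x<x) = <ₗ-irrefl x<x

<ₗ-trans : ∀ {x y z} → x <ₗ y → y <ₗ z → x <ₗ z
<ₗ-trans []<∷        (here _)    = []<∷
<ₗ-trans []<∷        (there _)   = []<∷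
<ₗ-trans (here a<b)  (here b<c)  = here (<-trans a<b b<c)
<ₗ-trans (here a<b)  (there _)   = here a<b
<ₗ-trans (there _)   (here b<c)  = here b<c
<ₗ-trans (there x<y) (there y<z) = there (<ₗ-trans x<y y<z)

≤ₗ⇒≯ₗ : ∀ {x y} → x ≤ₗ y → ¬ y <ₗ x
≤ₗ⇒≯ₗ (inj₁ x<y)  y<x = <ₗ-irrefl (<ₗ-trans x<y y<x)
≤ₗ⇒≯ₗ (inj₂ refl) x<x = <ₗ-irrefl x<x

++-monoʳ-<ₗ : ∀ u {x y} → x <ₗ y → (u ++ x) <ₗ (u ++ y)
++-monoʳ-<ₗ []      x<y = x<y
++-monoʳ-<ₗ (a ∷ u) x<y = there (++-monoʳ-<ₗ u x<y)

++-monoʳ-≤ₗ : ∀ u {x y} → x ≤ₗ y → (u ++ x) ≤ₗ (u ++ y)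
++-monoʳ-≤ₗ u (inj₁ x<y)  = inj₁ (++-monoʳ-<ₗ u x<y)
++-monoʳ-≤ₗ u (inj₂ refl) = inj₂ refl

<ₗ-++ : ∀ {u v} x y → length u ≡ length v → u <ₗ v → (u ++ x) <ₗ (v ++ y)
<ₗ-++ x y ()  []<∷
<ₗ-++ x y _   (here a<b)  = here a<b
<ₗ-++ x y len (there u<v) = there (<ₗ-++ x y (suc-injective len) u<v)

≤ₗ-∷⁻ : ∀ {a b x y} → (a ∷ x) ≤ₗ (b ∷ y) → a < b ⊎ (a ≡ b × x ≤ₗ y)
≤ₗ-∷⁻ (inj₁ (here a<b))  = inj₁ a<b
≤ₗ-∷⁻ (inj₁ (there x<y)) = inj₂ (refl , inj₁ x<y)
≤ₗ-∷⁻ (inj₂ refl)        = inj₂ (refl , inj₂ refl)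

≤ₗ-head : ∀ {a b x y} → (a ∷ x) ≤ₗ (b ∷ y) → a ≤ b
≤ₗ-head = [ <⇒≤ , ≤-reflexive ∘ proj₁ ]′ ∘ ≤ₗ-∷⁻

≤ₗ-tail : ∀ {a x y} → (a ∷ x) ≤ₗ (a ∷ y) → x ≤ₗ y
≤ₗ-tail = [ ⊥-elim ∘ <-irrefl refl , proj₂ ]′ ∘ ≤ₗ-∷⁻

≤ₗ-++⁻ : ∀ u v {x y} → length u ≡ length v → (u ++ x) ≤ₗ (v ++ y) → u <ₗ v ⊎ (u ≡ v × x ≤ₗ y)
≤ₗ-++⁻ []      []      _   x≤y = inj₂ (refl , x≤y)
≤ₗ-++⁻ (a ∷ u) (b ∷ v) len le with ≤ₗ-∷⁻ le
... | inj₁ a<b = inj₁ (here a<b)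
... | inj₂ (refl , le′) with ≤ₗ-++⁻ u v (suc-injective len) le′
...   | inj₁ u<v          = inj₁ (there u<v)
...   | inj₂ (refl , x≤y) = inj₂ (refl , x≤y)

data Diverge : List ℕ → List ℕ → Set where
  diverge : ∀ P {a b} R R′ → a < b → Diverge (P ++ a ∷ R) (P ++ b ∷ R′)

<ₗ⇒Diverge : ∀ {x y} → length x ≡ length y → x <ₗ y → Diverge x y
<ₗ⇒Diverge ()  []<∷
<ₗ⇒Diverge _   (here a<b)  = diverge [] _ _ a<b
<ₗ⇒Diverge len (there x<y) with <ₗ⇒Diverge (suc-injective len) x<y
... | diverge P R R′ a<b = diverge (_ ∷ P) R R′ a<b

Prefix-++ʳ : ∀ z {x y} → Prefix x y → Prefix x (y ++ z)
Prefix-++ʳ z {x} (r , refl) = r ++ z , sym (++-assoc x r z)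

Prefix-++⁺ : ∀ u {x y} → Prefix x y → Prefix (u ++ x) (u ++ y)
Prefix-++⁺ u {x} (r , refl) = r , ++-assoc u x r

Prefix-shorter : ∀ {x y z} → Prefix x z → Prefix y z → length x ≤ length y → Prefix x y
Prefix-shorter {y = y} (r , refl) (r′ , e) |x|≤|y| with m , y≡xm , _ ← ++-split y e |x|≤|y| =
  m , sym y≡xm

Prefix-squeeze : ∀ x {y y′ z} → (x ++ y) ≤ₗ z → z ≤ₗ (x ++ y′) → Prefix x z
Prefix-squeeze []      {z = z}     _          _  = z , refl
Prefix-squeeze (a ∷ x) {z = []}    (inj₁ ())  _
Prefix-squeeze (a ∷ x) {z = []}    (inj₂ ())  _
Prefix-squeeze (a ∷ x) {z = b ∷ z} lo hi with ≤-antisym (≤ₗ-head lo) (≤ₗ-head hi)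
... | refl = map₂ (cong (a ∷_)) (Prefix-squeeze x (≤ₗ-tail lo) (≤ₗ-tail hi))

common-Prefix-≤ : ∀ {x P a b R R′} → Prefix x (P ++ a ∷ R) → Prefix x (P ++ b ∷ R′) → a ≢ b →
                  length x ≤ length P
common-Prefix-≤ {[]}                _       _        _   = z≤n
common-Prefix-≤ {c ∷ x} {[]}        (_ , refl) (_ , refl) a≢b = ⊥-elim (a≢b refl)
common-Prefix-≤ {c ∷ x} {d ∷ P} (r , e) (r′ , e′) a≢b =
  s≤s (common-Prefix-≤ (r , ∷-injectiveʳ e) (r′ , ∷-injectiveʳ e′) a≢b)

Prefix-period-shift : ∀ {x r δ} (t : List ℕ) j → x ++ r ≡ δ → δ ≡ concat (replicate (suc j) t) →
                      length t ≤ length x → ∃ λ x′ → x ≡ t ++ x′ × δ ≡ x′ ++ r ++ t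
Prefix-period-shift {x} {r} t j refl δ≡tʲ⁺¹ |t|≤|x|
  with x′ , refl , T≡x′r ← ++-split x {v = t} δ≡tʲ⁺¹ |t|≤|x| = x′ , refl , (begin
    (t ++ x′) ++ r  ≡⟨ δ≡tʲ⁺¹ ⟩
    t ++ T          ≡⟨ concat-replicate-comm j t ⟩
    T ++ t          ≡⟨ cong (_++ t) T≡x′r ⟩
    (x′ ++ r) ++ t  ≡⟨ ++-assoc x′ r t ⟩
    x′ ++ r ++ t    ∎)
  where
    open ≡-Reasoning
    T = concat (replicate j t)

-- Necklaces

necklace-intro : ∀ {xs} → (∀ u v → xs ≡ u ++ v → xs ≤ₗ (v ++ u)) → IsNecklace xs
necklace-intro {xs} least i _ = least (take i xs) (drop i xs) (sym (take++drop≡id i xs))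

necklace-≤ₗ-rotation : ∀ {xs} → IsNecklace xs → ∀ u v → xs ≡ u ++ v → xs ≤ₗ (v ++ u)
necklace-≤ₗ-rotation _    u []      refl = inj₂ (++-identityʳ u)
necklace-≤ₗ-rotation neck u (b ∷ v) refl =
  subst₂ (λ d t → (u ++ b ∷ v) ≤ₗ (d ++ t)) (drop-length-++ u) (take-length-++ u)
         (neck (length u) (subst (length u <_) (sym (length-++-sucʳ u b v)) (s≤s (length-++-≤ˡ u))))

necklace-head-min : ∀ {a as} → IsNecklace (a ∷ as) → All (a ≤_) (a ∷ as)
necklace-head-min neck = All.tabulate λ b∈ →
  let u , v , split = ∈-∃++ b∈ in ≤ₗ-head (necklace-≤ₗ-rotation neck u (_ ∷ v) split)

necklace-head< : ∀ {k a as} → IsNecklace (a ∷ as) → Any (_< k) (a ∷ as) → a < k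
necklace-head< {k} neck below =
  All.lookupWith {R = λ _ → _ < k} ≤-<-trans (necklace-head-min neck) below

necklace-prefix-below : ∀ {k x z t} → IsNecklace (x ++ z) → Any (_< k) (z ++ x) → Prefix t x → t ≢ [] →
                        Any (_< k) t
necklace-prefix-below {t = []}    _    _     _          t≢[] = ⊥-elim (t≢[] refl)
necklace-prefix-below {z = z} {t = c ∷ t} neck below (_ , refl) _ =
  here (necklace-head< neck (Any.++-comm z _ below))

-- If |τ| ≤ |P| then P = τ P′, and the period τ gives P = P′ b m′; so the rotation
-- P′ a R τ of τ P′ a R = P′ b m′ a R is smaller.
necklace-diverges-within-period : ∀ {P a b R R′ V c} t → IsNecklace (P ++ a ∷ R) → a < b →
  P ++ b ∷ R′ ≡ (c ∷ t) ++ V → (c ∷ t) ++ V ≡ V ++ (c ∷ t) → length P < length (c ∷ t)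
necklace-diverges-within-period {P} {a} {b} {R} {R′} {V} {c} t neck a<b δ′≡τV period
  with length (c ∷ t) ≤? length P
... | no |τ|≰|P| = ≰⇒> |τ|≰|P|
... | yes |τ|≤|P| with P′ , refl , refl ← ++-split P {v = c ∷ t} δ′≡τV |τ|≤|P| =
  ⊥-elim (≤ₗ⇒≯ₗ (necklace-≤ₗ-rotation neck τ (P′ ++ a ∷ R) (++-assoc τ P′ (a ∷ R))) smaller)
  where
    τ : List ℕ
    τ = c ∷ t
    τP′≡P′bm′ : ∃ λ m′ → τ ++ P′ ≡ P′ ++ b ∷ m′
    τP′≡P′bm′ = ++-split-< (τ ++ P′)
      (trans (++-assoc τ P′ (b ∷ R′)) (trans period (++-assoc P′ (b ∷ R′) τ)))
      (s≤s (length-++-≤ʳ P′ {t}))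
    m′ : List ℕ
    m′ = proj₁ τP′≡P′bm′
    smaller : ((P′ ++ a ∷ R) ++ τ) <ₗ ((τ ++ P′) ++ a ∷ R)
    smaller = subst₂ _<ₗ_ (sym (++-assoc P′ (a ∷ R) τ))
                (sym (trans (cong (_++ a ∷ R) (proj₂ τP′≡P′bm′)) (++-assoc P′ (b ∷ m′) (a ∷ R))))
                (++-monoʳ-<ₗ P′ (here a<b))

maxed-or-below : ∀ {k xs} → All (_≤ k) xs → All (_≡ k) xs ⊎ Any (_< k) xs
maxed-or-below [] = inj₁ []
maxed-or-below (a≤k ∷ as≤k) with m≤n⇒m<n∨m≡n a≤k | maxed-or-below as≤k
... | inj₁ a<k | _              = inj₂ (here a<k)
... | inj₂ a≡k | inj₁ as-maxed  = inj₁ (a≡k ∷ as-maxed)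
... | inj₂ _   | inj₂ as-below  = inj₂ (there as-below)

maxed⇒¬below : ∀ {k xs} → All (_≡ k) xs → ¬ Any (_< k) xs
maxed⇒¬below {k} maxed = All¬⇒¬Any (All.map (λ a≡k → <-irrefl {y = k} a≡k) maxed)

<ₗ-replicate : ∀ {k m xs} ys zs → All (_≤ k) xs → Any (_< k) xs → length xs ≤ m →
               (xs ++ ys) <ₗ (replicate m k ++ zs)
<ₗ-replicate ys zs (a≤k ∷ _) (here a<k) (s≤s _) = here a<k
<ₗ-replicate ys zs (a≤k ∷ as≤k) (there as-below) (s≤s |as|≤m) with m≤n⇒m<n∨m≡n a≤k
... | inj₁ a<k  = here a<k
... | inj₂ refl = there (<ₗ-replicate ys zs as≤k as-below |as|≤m)

<ₗ-maxSuffix : ∀ {k} x {y} → All (_≤ k) y → Any (_< k) y → (x ++ y) <ₗ (x ++ replicate (length y) k)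
<ₗ-maxSuffix {k} x {y} y≤k y-below =
  ++-monoʳ-<ₗ x (subst₂ _<ₗ_ (++-identityʳ y) (++-identityʳ (replicate (length y) k))
                        (<ₗ-replicate [] [] y≤k y-below ≤-refl))

≤ₗ-maxSuffix : ∀ {k} x {y} → All (_≤ k) y → (x ++ y) ≤ₗ (x ++ replicate (length y) k)
≤ₗ-maxSuffix x y≤k with maxed-or-below y≤k
... | inj₁ y-maxed = inj₂ (cong (x ++_) (All-≡⇒replicate y-maxed))
... | inj₂ y-below = inj₁ (<ₗ-maxSuffix x y≤k y-below)

weight-≤-replicate : ∀ {k xs} → All (_≤ k) xs → weight xs ≤ weight (replicate (length xs) k)
weight-≤-replicate []           = z≤n
weight-≤-replicate (a≤k ∷ as≤k) = +-mono-≤ a≤k (weight-≤-replicate as≤k)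

weight-maxSuffix : ∀ {k} x {y} → All (_≤ k) y → weight (x ++ y) ≤ weight (x ++ replicate (length y) k)
weight-maxSuffix {k} x {y} y≤k = begin
  weight (x ++ y)                              ≡⟨ sum-++ x y ⟩
  weight x + weight y                          ≤⟨ +-monoʳ-≤ (weight x) (weight-≤-replicate y≤k) ⟩
  weight x + weight (replicate (length y) k)   ≡⟨ sum-++ x _ ⟨
  weight (x ++ replicate (length y) k)         ∎
  where open ≤-Reasoning

weight-rotate-maxSuffix : ∀ {k} p q r → All (_≤ k) p → length (p ++ q) ≡ length (q ++ r) →
                          weight (p ++ q) ≤ weight (q ++ replicate (length r) k)
weight-rotate-maxSuffix {k} p q r p≤k |pq|≡|qr| = begin
  weight (p ++ q)                        ≡⟨ sum-↭ (++-comm p q) ⟩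
  weight (q ++ p)                        ≤⟨ weight-maxSuffix q p≤k ⟩
  weight (q ++ replicate (length p) k)   ≡⟨ cong (λ l → weight (q ++ replicate l k)) |p|≡|r| ⟩
  weight (q ++ replicate (length r) k)   ∎
  where
    open ≤-Reasoning
    |p|≡|r| : length p ≡ length r
    |p|≡|r| = +-cancelˡ-≡ (length q) _ _
      (trans (sym (length-++ q)) (trans (length-++-comm q p) (trans |pq|≡|qr| (length-++ q))))

maxed-necklace : ∀ {k xs} → All (_≡ k) xs → IsNecklace xs
maxed-necklace {k} {xs} xs-maxed = necklace-intro λ u v xs≡uv →
  let uv-maxed = subst (All (_≡ k)) xs≡uv xs-maxed
      vu-maxed = ++⁺ (++⁻ʳ u uv-maxed) (++⁻ˡ u uv-maxed)
  in inj₂ (begin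
    xs                             ≡⟨ All-≡⇒replicate xs-maxed ⟩
    replicate (length xs) k        ≡⟨ cong (λ l → replicate l k) (cong length xs≡uv) ⟩
    replicate (length (u ++ v)) k  ≡⟨ cong (λ l → replicate l k) (length-++-comm u v) ⟩
    replicate (length (v ++ u)) k  ≡⟨ All-≡⇒replicate vu-maxed ⟨
    v ++ u                         ∎)
  where open ≡-Reasoning

-- Replacing a suffix of a necklace by k's

-- x₃ is not all k's, being a conjugate of u, which contains a symbol below k; and a prefix
-- of x₃ of length |y| made of k's would force y = k^|y| through x₃ y ≤ y u.
maxSuffix-core : ∀ {k} u m x₃ y → u ++ m ≡ m ++ x₃ → Any (_< k) u → All (_≤ k) x₃ →
  All (_≤ k) y → Any (_< k) y → (x₃ ++ y) ≤ₗ (y ++ u) →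
  (x₃ ++ replicate (length y) k) ≤ₗ (replicate (length y) k ++ u)
maxSuffix-core u m x₃ y um≡mx₃ u-below x₃≤k y≤k y-below x₃y≤yu with length x₃ ≤? length y
... | yes |x₃|≤|y| with maxed-or-below x₃≤k
...   | inj₁ x₃-maxed = ⊥-elim (maxed⇒¬below (All-conjugate u m um≡mx₃ x₃-maxed) u-below)
...   | inj₂ x₃-below = inj₁ (<ₗ-replicate _ u x₃≤k x₃-below |x₃|≤|y|)
maxSuffix-core {k} u m x₃ y um≡mx₃ u-below x₃≤k y≤k y-below x₃y≤yu | no |x₃|≰|y|
  with X , R , refl , |X|≡|y| ← splitAt-length (length y) x₃ (<⇒≤ (≰⇒> |x₃|≰|y|))
  with maxed-or-below (++⁻ˡ X x₃≤k)
... | inj₂ X-below = inj₁ (subst (_<ₗ _) (sym (++-assoc X R _))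
                        (<ₗ-replicate _ u (++⁻ˡ X x₃≤k) X-below (≤-reflexive |X|≡|y|)))
... | inj₁ X-maxed = ⊥-elim (≤ₗ⇒≯ₗ (subst (_≤ₗ (y ++ u)) (++-assoc X R y) x₃y≤yu)
                        (subst (λ z → (y ++ u) <ₗ (z ++ R ++ y)) (sym X≡kʸ)
                               (<ₗ-replicate u (R ++ y) y≤k y-below ≤-refl)))
  where
    X≡kʸ : X ≡ replicate (length y) k
    X≡kʸ = trans (All-≡⇒replicate X-maxed) (cong (λ l → replicate l k) |X|≡|y|)

maxSuffix-≤ₗ-innerRotation : ∀ {k} x u m y → x ≡ u ++ m → Any (_< k) u → All (_≤ k) x →
  All (_≤ k) y → Any (_< k) y → IsNecklace (x ++ y) →
  (x ++ replicate (length y) k) ≤ₗ ((m ++ replicate (length y) k) ++ u)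
maxSuffix-≤ₗ-innerRotation {k} x u m y x≡um u-below x≤k y≤k y-below neck
  with m′ , x₃ , refl , |m′|≡|m| ←
         splitAt-length (length m) x (subst (λ z → length m ≤ length z) (sym x≡um) (length-++-≤ʳ m {u}))
  with ≤ₗ-++⁻ m′ m |m′|≡|m| (subst₂ _≤ₗ_ (++-assoc m′ x₃ y) (++-assoc m y u)
         (necklace-≤ₗ-rotation neck u (m ++ y) (trans (cong (_++ y) x≡um) (++-assoc u m y))))
... | inj₁ m′<m =
  inj₁ (subst₂ _<ₗ_ (sym (++-assoc m′ x₃ _)) (sym (++-assoc m _ u)) (<ₗ-++ _ _ |m′|≡|m| m′<m))
... | inj₂ (refl , x₃y≤yu) = subst₂ _≤ₗ_ (sym (++-assoc m x₃ _)) (sym (++-assoc m _ u))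
  (++-monoʳ-≤ₗ m (maxSuffix-core u m x₃ y (sym x≡um) u-below (++⁻ʳ m x≤k) y≤k y-below x₃y≤yu))

maxSuffix-≤ₗ-rotation : ∀ {k} x₀ x y → x₀ < k → IsNecklace (x₀ ∷ x ++ y) → All (_≤ k) (x₀ ∷ x ++ y) →
  Any (_< k) y → ∀ u v → (x₀ ∷ x ++ replicate (length y) k) ≡ u ++ v →
  (x₀ ∷ x ++ replicate (length y) k) ≤ₗ (v ++ u)
maxSuffix-≤ₗ-rotation x₀ x y _ _ _ _ u [] e = inj₂ (trans e (++-identityʳ u))
maxSuffix-≤ₗ-rotation x₀ x y _ _ _ _ [] v e = inj₂ (trans e (sym (++-identityʳ v)))
maxSuffix-≤ₗ-rotation {k} x₀ x y x₀<k neck bnd y-below (u₀ ∷ u) (b ∷ v) e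
  with length (x₀ ∷ x) ≤? length (u₀ ∷ u)
... | yes |x|≤|u| with m , _ , K≡mbv ← ++-split (u₀ ∷ u) {v = x₀ ∷ x} (sym e) |x|≤|u| =
  inj₁ (here (subst (x₀ <_) (sym b≡k) x₀<k))
  where
    b≡k : b ≡ k
    b≡k = All.head (++⁻ʳ m (subst (All (_≡ k)) K≡mbv (replicate⁺ (length y) refl)))
... | no |x|≰|u| with m , x≡um , v≡mK ← ++-split (x₀ ∷ x) {v = u₀ ∷ u} e (<⇒≤ (≰⇒> |x|≰|u|)) =
  subst (λ z → _ ≤ₗ (z ++ u₀ ∷ u)) (sym v≡mK)
    (maxSuffix-≤ₗ-innerRotation (x₀ ∷ x) (u₀ ∷ u) m y x≡um (here u₀<k)
       (++⁻ˡ (x₀ ∷ x) bnd) (++⁻ʳ (x₀ ∷ x) bnd) y-below neck)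
  where
    u₀<k : u₀ < k
    u₀<k = subst (_< k) (proj₁ (∷-injective x≡um)) x₀<k

necklace-maxSuffix : ∀ {k} x y → IsNecklace (x ++ y) → All (_≤ k) (x ++ y) →
                     IsNecklace (x ++ replicate (length y) k)
necklace-maxSuffix []        y _    _   = maxed-necklace (replicate⁺ (length y) refl)
necklace-maxSuffix (x₀ ∷ x) y neck bnd with maxed-or-below (++⁻ʳ (x₀ ∷ x) bnd)
... | inj₁ y-maxed = subst (λ z → IsNecklace (x₀ ∷ x ++ z)) (All-≡⇒replicate y-maxed) neck
... | inj₂ y-below = necklace-intro
  (maxSuffix-≤ₗ-rotation x₀ x y (necklace-head< neck (Any.++⁺ʳ (x₀ ∷ x) y-below)) neck bnd y-below)

maxSuffix-∈Nw : ∀ {k n w x y} → 1 ≤ k → InN k n (x ++ y) → w ≤ weight (x ++ replicate (length y) k) →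
                InNw k n w (x ++ replicate (length y) k)
maxSuffix-∈Nw {k} {x = x} {y} 1≤k ((|xy|≡n , bnd) , neck) w≤ =
  ((|xK|≡n , ++⁺ (++⁻ˡ x bnd) (replicate⁺ (length y) (1≤k , ≤-refl))) , w≤) ,
  necklace-maxSuffix x y neck (All.map proj₂ bnd)
  where
    open ≡-Reasoning
    |xK|≡n : length (x ++ replicate (length y) k) ≡ _
    |xK|≡n = begin
      length (x ++ replicate (length y) k)     ≡⟨ length-++ x ⟩
      length x + length (replicate (length y) k) ≡⟨ cong (length x +_) (length-replicate (length y)) ⟩
      length x + length y                        ≡⟨ length-++ x ⟨
      length (x ++ y)                            ≡⟨ |xy|≡n ⟩
      _                                          ∎

CyclicNext-least : ∀ {P a b c} → CyclicNext P a b → P c → a <ₗ c → a <ₗ b × b ≤ₗ c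
CyclicNext-least (_ , _ , inj₁ (a<b , least)) c∈P a<c = a<b , least _ c∈P a<c
CyclicNext-least (_ , _ , inj₂ (≤a , _))      c∈P a<c = ⊥-elim (≤ₗ⇒≯ₗ (≤a _ c∈P) a<c)

Prefix-least-above : ∀ {k n w x y δ} → 1 ≤ k → InN k n (x ++ y) →
  w ≤ weight (x ++ replicate (length y) k) →
  (x ++ y) ≤ₗ δ → (∀ t → InNw k n w t → (x ++ y) ≤ₗ t → δ ≤ₗ t) → Prefix x δ
Prefix-least-above {x = x} {y} 1≤k xy∈N@((_ , bnd) , _) w≤ xy≤δ least =
  Prefix-squeeze x xy≤δ
    (least _ (maxSuffix-∈Nw {x = x} 1≤k xy∈N w≤) (≤ₗ-maxSuffix x (All.map proj₂ (++⁻ʳ x bnd))))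

Prefix-root : ∀ {δ δ′ x t} i → IsNecklace δ → length δ ≡ length δ′ → δ <ₗ δ′ →
  Prefix x δ → Prefix x δ′ → δ′ ≡ concat (replicate i t) → Prefix x t
Prefix-root zero _ _ () _ _ refl
Prefix-root {t = []} (suc i) _ _ δ<δ′ _ _ δ′≡[]ⁱ with refl ← trans δ′≡[]ⁱ (concat-replicate-[] i) =
  case δ<δ′ of λ ()
Prefix-root {t = c ∷ t} (suc i) neck len δ<δ′ x≺δ x≺δ′ δ′≡tⁱ with <ₗ⇒Diverge len δ<δ′
... | diverge P R R′ a<b =
  Prefix-shorter x≺δ′ (_ , sym δ′≡tⁱ)
    (≤-trans (common-Prefix-≤ x≺δ x≺δ′ (<⇒≢ a<b))
             (<⇒≤ (necklace-diverges-within-period t neck a<b δ′≡tⁱ (concat-replicate-comm i (c ∷ t)))))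

Prefix-root-of-next : ∀ {k n w x y δ′ t} i → 1 ≤ k → InNw k n w (x ++ y) → Any (_< k) y →
  CyclicNext (InNw k n w) (x ++ y) δ′ → δ′ ≡ concat (replicate i t) → Prefix x t
Prefix-root-of-next {k} {n} {w} {x} {y} {δ′} i 1≤k (((|xy|≡n , bnd) , w≤xy) , neck) y-below
                    next@(_ , (((|δ′|≡n , _) , _) , _) , _) δ′≡tⁱ =
  Prefix-root i neck (trans |xy|≡n (sym |δ′|≡n)) xy<δ′ (y , refl)
    (Prefix-squeeze x (inj₁ xy<δ′) δ′≤c) δ′≡tⁱ
  where
    y≤k : All (_≤ k) y
    y≤k = All.map proj₂ (++⁻ʳ x bnd)
    c∈ : InNw k n w (x ++ replicate (length y) k)
    c∈ = maxSuffix-∈Nw {x = x} 1≤k ((|xy|≡n , bnd) , neck) (≤-trans w≤xy (weight-maxSuffix x y≤k))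
    bounds : (x ++ y) <ₗ δ′ × δ′ ≤ₗ (x ++ replicate (length y) k)
    bounds = CyclicNext-least next c∈ (<ₗ-maxSuffix x y≤k y-below)
    xy<δ′ : (x ++ y) <ₗ δ′
    xy<δ′ = proj₁ bounds
    δ′≤c : δ′ ≤ₗ (x ++ replicate (length y) k)
    δ′≤c = proj₂ bounds

m*n>0⇒m>0∧n>0 : ∀ m n → 0 < m * n → 0 < m × 0 < n
m*n>0⇒m>0∧n>0 m n mn>0 = >-nonZero⁻¹ m {{m*n≢0⇒m≢0 m}} , >-nonZero⁻¹ n {{m*n≢0⇒n≢0 m}}
  where instance _ = >-nonZero mn>0

lemma2 : (n k w : ℕ) → k < w → w < k * n →
    (α₁ : List ℕ) → InNw k n w α₁ → (∀ t → InNw k n w t → α₁ ≤ₗ t) →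
    (s : List ℕ) → InSw k n w s →
    (∀ j → j < n → s ≢ replicate (n ∸ j) k ++ take j α₁) →
    (p q : List ℕ) → s ≡ p ++ q → IsNecklace (q ++ p) →
    (∀ p′ q′ → s ≡ p′ ++ q′ → length q < length q′ → ¬ IsNecklace (q′ ++ p′)) →
    (β₁ β₂ : List ℕ) → CyclicNext (InN k n) β₁ β₂ → Suffix p β₁ → Prefix q β₂ →
    (δ₂ : List ℕ) → InNw k n w δ₂ → β₂ ≤ₗ δ₂ →
    (∀ t → InNw k n w t → β₂ ≤ₗ t → δ₂ ≤ₗ t) →
    (δ₃ : List ℕ) → CyclicNext (InNw k n w) δ₂ δ₃ →
    (t₂ t₃ : List ℕ) → IsAp t₂ δ₂ → IsAp t₃ δ₃ → Prefix q (t₂ ++ t₃)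
lemma2 n k w _ w<kn _ _ _ _ ((|s|≡n , s-bnd) , w≤s) s≢kⁿ p q refl qp-neck _
       _ _ (_ , β₂∈N@((|β₂|≡n , _) , _) , _) _ (r , refl) δ₂ δ₂∈@(((|δ₂|≡n , _) , _) , _) β₂≤δ₂ δ₂-least
       δ₃ δ₂→δ₃ t₂ t₃ ((suc j , _ , δ₂≡t₂ʲ) , _) ((i , _ , δ₃≡t₃ⁱ) , _)
  with 1≤k , 0<n ← m*n>0⇒m>0∧n>0 k n (m<n⇒0<n w<kn)
  with r₁ , q++r₁≡δ₂ ← Prefix-least-above 1≤k β₂∈N
         (≤-trans w≤s (weight-rotate-maxSuffix p q r (All.map proj₂ (++⁻ˡ p s-bnd))
                                                     (trans |s|≡n (sym |β₂|≡n))))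
         β₂≤δ₂ δ₂-least
  with length q ≤? length t₂
... | yes |q|≤|t₂| = Prefix-++ʳ t₃ (Prefix-shorter (r₁ , q++r₁≡δ₂) (_ , sym δ₂≡t₂ʲ) |q|≤|t₂|)
... | no |q|≰|t₂|
  with q″ , refl , refl ← Prefix-period-shift {x = q} t₂ j q++r₁≡δ₂ δ₂≡t₂ʲ (<⇒≤ (≰⇒> |q|≰|t₂|)) =
  Prefix-++⁺ t₂ (Prefix-root-of-next i 1≤k δ₂∈ (Any.++⁺ʳ r₁ t₂-below) δ₂→δ₃ δ₃≡t₃ⁱ)
  where
    s-below : Any (_< k) (p ++ t₂ ++ q″)
    s-below with maxed-or-below (All.map proj₂ s-bnd)
    ... | inj₂ below = below
    ... | inj₁ maxed = ⊥-elim (s≢kⁿ 0 0<n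
          (trans (All-≡⇒replicate maxed)
                 (trans (cong (λ l → replicate l k) |s|≡n) (sym (++-identityʳ _)))))
    t₂-below : Any (_< k) t₂
    t₂-below = necklace-prefix-below qp-neck s-below (q″ , refl)
      (root-nonempty (suc j) (subst (0 <_) (sym |δ₂|≡n) 0<n) δ₂≡t₂ʲ)
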